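{- If $G$ is a graph of girth $4$ that has no isolatable vertex, then $G\Box K_2$ is well-covered.
   Context: All graphs are finite and simple. A graph is well-covered if all its maximal independent sets have the same cardinality. The girth of a graph is the length of its shortest cycle. A vertex $w$ of a graph $X$ is isolatable in $X$ if there exists an independent set $J$ of $X$ such that $V(X)-N[J]=\{w\}$, where $N[J]$ is $J$ together with all vertices adjacent to some vertex of $J$. The Cartesian product $G \Box K_2$ (the prism of $G$) has vertex set $V(G)\times\{1,2\}$, with $(g_1,i)$ adjacent to $(g_2,j)$ if either $g_1=g_2$ and $i\neq j$, or $i=j$ and $g_1g_2\in E(G)$. -}

module Defs where

open import Data.Nat using (ℕ; zero; suc; _+_; _≤_; _<_)
open import Data.Bool using (Bool; true; false)
open import Data.Fin using (Fin; toℕ; splitAt; _≟_)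
open import Data.Fin.Subset using (Subset; _∈_; _∉_; ∣_∣)
open import Data.Sum using (_⊎_; inj₁; inj₂)
open import Data.Product using (Σ; ∃; _×_; _,_)
open import Data.Empty using (⊥)
open import Relation.Nullary using (¬_; does; yes; no)
open import Relation.Binary.PropositionalEquality using (_≡_; refl; sym)
open import Function.Definitions using (Injective)

record Graph : Set where
  field
    n       : ℕ
    Adj     : Fin n → Fin n → Bool
    sym-adj : ∀ u v → Adj u v ≡ Adj v u
    irrefl  : ∀ v → Adj v v ≡ false

open Graph public

module _ (G : Graph) where

  Adjacent : Fin (n G) → Fin (n G) → Set
  Adjacent u v = Adj G u v ≡ true

  Independent : Subset (n G) → Set
  Independent S = ∀ u v → u ∈ S → v ∈ S → ¬ Adjacent u v

  MaximalIndependent : Subset (n G) → Set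
  MaximalIndependent S =
    Independent S ×
    (∀ (T : Subset (n G)) → Independent T → (∀ v → v ∈ S → v ∈ T) →
       ∀ v → v ∈ T → v ∈ S)

  WellCovered : Set
  WellCovered = ∀ S T → MaximalIndependent S → MaximalIndependent T → ∣ S ∣ ≡ ∣ T ∣

  InClosedNbhd : Subset (n G) → Fin (n G) → Set
  InClosedNbhd J x = x ∈ J ⊎ Σ (Fin (n G)) (λ j → j ∈ J × Adjacent j x)

  Isolatable : Fin (n G) → Set
  Isolatable w = Σ (Subset (n G)) λ J →
    Independent J × ¬ InClosedNbhd J w × (∀ x → ¬ InClosedNbhd J x → x ≡ w)

  HasCycle : ℕ → Set
  HasCycle k = 3 ≤ k × Σ (Fin k → Fin (n G)) λ f →
    Injective _≡_ _≡_ f ×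
    (∀ i j → (suc (toℕ i) ≡ toℕ j ⊎ (suc (toℕ i) ≡ k × toℕ j ≡ 0)) →
       Adjacent (f i) (f j))

  HasGirth : ℕ → Set
  HasGirth g = HasCycle g × (∀ k → k < g → ¬ HasCycle k)

-- Prism G □ K₂ on vertex set Fin (n + n): splitAt n sends a vertex to
-- inj₁ g = (g,1) or inj₂ g = (g,2).
prismAdj⊎ : ∀ {m} → (Fin m → Fin m → Bool) → Fin m ⊎ Fin m → Fin m ⊎ Fin m → Bool
prismAdj⊎ A (inj₁ a) (inj₁ b) = A a b
prismAdj⊎ A (inj₂ a) (inj₂ b) = A a b
prismAdj⊎ A (inj₁ a) (inj₂ b) = does (a ≟ b)
prismAdj⊎ A (inj₂ a) (inj₁ b) = does (a ≟ b)

private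
  does-sym : ∀ {m} (a b : Fin m) → does (a ≟ b) ≡ does (b ≟ a)
  does-sym a b with a ≟ b | b ≟ a
  ... | yes _ | yes _ = refl
  ... | no _  | no _  = refl
  ... | yes p | no q  with q (sym p)
  ... | ()
  does-sym a b | no q | yes p with q (sym p)
  ... | ()

  prism-sym⊎ : ∀ {m} (A : Fin m → Fin m → Bool) → (∀ u v → A u v ≡ A v u) →
               ∀ x y → prismAdj⊎ A x y ≡ prismAdj⊎ A y x
  prism-sym⊎ A s (inj₁ a) (inj₁ b) = s a b
  prism-sym⊎ A s (inj₂ a) (inj₂ b) = s a b
  prism-sym⊎ A s (inj₁ a) (inj₂ b) = does-sym a b
  prism-sym⊎ A s (inj₂ a) (inj₁ b) = does-sym a b

  prism-irr⊎ : ∀ {m} (A : Fin m → Fin m → Bool) → (∀ v → A v v ≡ false) →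
               ∀ x → prismAdj⊎ A x x ≡ false
  prism-irr⊎ A i (inj₁ a) = i a
  prism-irr⊎ A i (inj₂ a) = i a

prism : Graph → Graph
prism G = record
  { n       = n G + n G
  ; Adj     = λ x y → prismAdj⊎ (Adj G) (splitAt (n G) x) (splitAt (n G) y)
  ; sym-adj = λ x y → prism-sym⊎ (Adj G) (sym-adj G) (splitAt (n G) x) (splitAt (n G) y)
  ; irrefl  = λ x → prism-irr⊎ (Adj G) (irrefl G) (splitAt (n G) x)
  }

-- If G has no isolatable vertex, each layer of a maximal independent set I of G □ K₂ is a
-- maximal independent set of G: the vertices of G not dominated by the top layer A all lie in
-- the bottom layer, so they form an independent set U, and if U contained v then A ∪ (U − v)
-- would isolate v.  Hence |I| is a sum of sizes of two maximal independent sets of G, and it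
-- remains to see that G is well-covered.  For triangle-free G without isolatable vertices this
-- goes by induction on a common subset S of maximal independent sets M₁, M₂.  A non-adjacent
-- pair v ∈ M₁ − S, u ∈ M₂ − S lets us pass through a maximal set containing S ∪ {v, u}.
-- Otherwise M₁ − S and M₂ − S are completely joined, and M₁ − S has at most one vertex: if it
-- had two, M₁ − v would isolate one of them, v.
module Submission where

open import Defs

open import Level using (Level)
open import Data.Bool using (true; _≟_)
open import Data.Empty using (⊥; ⊥-elim)
open import Data.Fin using (Fin; zero; suc; toℕ; _↑ˡ_; _↑ʳ_; join; splitAt) renaming (_≟_ to _≟ᶠ_)
open import Data.Fin.Subset
  using (Subset; Empty; _∈_; _∉_; _⊆_; _⊂_; _⊃_; _∪_; _─_; _-_; ⁅_⁆; ∣_∣; inside; outside)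
  renaming (⊥ to ∅)
open import Data.Fin.Properties using (any?; all?; ¬∀⟶∃¬; splitAt-join; join-splitAt)
open import Data.Fin.Subset.Properties
  using (_∈?_; ⊆-antisym; ⊆-trans; ⊥⊆; nonempty?; ∣p∣≤n; p⊂q⇒∣p∣<∣q∣; p─⊥≡p; p─q⊆p;
         x∈p∧x∉q⇒x∈p─q; x∈p∧x≢y⇒x∈p-y; x∈⁅x⁆; x∈⁅y⁆⇒x≡y; p⊆p∪q; q⊆p∪q; x∈p∪q⁺; x∈p∪q⁻)
open import Data.Nat using (ℕ; zero; suc; _+_; _∸_; _<_)
open import Data.Nat.Induction using (<-wellFounded)
open import Data.Nat.Properties using (≤-refl; ∸-monoʳ-<)
open import Data.Product using (∃; _×_; _,_; proj₁)
open import Data.Sum using (_⊎_; inj₁; inj₂)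
open import Data.Vec using (_∷_; lookup; tabulate; here; there)
open import Data.Vec.Properties using (lookup∘tabulate; tabulate∘lookup; []=⇒lookup; lookup⇒[]=)
open import Function using (_∘_; id)
open import Induction.WellFounded using (WellFounded; module Subrelation; module All)
open import Relation.Binary.Construct.On as On using ()
open import Relation.Nullary using (¬_; Dec; does; yes; no)
open import Relation.Nullary.Decidable using (dec-true; _⊎-dec_; _×-dec_; ¬?; decidable-stable)
open import Relation.Unary using (Pred; Decidable)
open import Relation.Binary.PropositionalEquality
  using (_≡_; _≢_; refl; sym; trans; cong; cong₂; subst; module ≡-Reasoning)

private
  variable
    ℓ : Level
    k : ℕ
    x y : Fin k
    p q : Subset k

fromDec : {P : Pred (Fin k) ℓ} → Decidable P → Subset k
fromDec P? = tabulate (does ∘ P?)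

module _ {P : Pred (Fin k) ℓ} (P? : Decidable P) where

  ∈-fromDec⁺ : P x → x ∈ fromDec P?
  ∈-fromDec⁺ {x} px = lookup⇒[]= x _ (trans (lookup∘tabulate _ x) (dec-true (P? x) px))

  ∈-fromDec⁻ : x ∈ fromDec P? → P x
  ∈-fromDec⁻ {x} x∈ with P? x | trans (sym (lookup∘tabulate _ x)) ([]=⇒lookup x∈)
  ... | yes px | _  = px
  ... | no _   | ()

preimage : ∀ {m} → (Fin m → Fin k) → Subset k → Subset m
preimage f p = tabulate (lookup p ∘ f)

module _ {m} {f : Fin m → Fin k} where

  ∈-preimage⁺ : {x : Fin m} → f x ∈ p → x ∈ preimage f p
  ∈-preimage⁺ {x = x} fx∈p = lookup⇒[]= x _ (trans (lookup∘tabulate _ x) ([]=⇒lookup fx∈p))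

  ∈-preimage⁻ : {x : Fin m} → x ∈ preimage f p → f x ∈ p
  ∈-preimage⁻ {p = p} {x} x∈ =
    lookup⇒[]= (f x) p (trans (sym (lookup∘tabulate _ x)) ([]=⇒lookup x∈))

∣p∣≡∣preimage↑ˡ∣+∣preimage↑ʳ∣ : ∀ a {b} (p : Subset (a + b)) →
  ∣ p ∣ ≡ ∣ preimage (_↑ˡ b) p ∣ + ∣ preimage (a ↑ʳ_) p ∣
∣p∣≡∣preimage↑ˡ∣+∣preimage↑ʳ∣ zero    p             = cong ∣_∣ (sym (tabulate∘lookup p))
∣p∣≡∣preimage↑ˡ∣+∣preimage↑ʳ∣ (suc a) (inside ∷ p)  = cong suc (∣p∣≡∣preimage↑ˡ∣+∣preimage↑ʳ∣ a p)
∣p∣≡∣preimage↑ˡ∣+∣preimage↑ʳ∣ (suc a) (outside ∷ p) = ∣p∣≡∣preimage↑ˡ∣+∣preimage↑ʳ∣ a p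

x∈p─q⇒x∉q : ∀ (p q : Subset k) → x ∈ p ─ q → x ∉ q
x∈p─q⇒x∉q (_ ∷ p) (outside ∷ q) here        ()
x∈p─q⇒x∉q (_ ∷ p) (outside ∷ q) (there x∈) (there x∈q) = x∈p─q⇒x∉q p q x∈ x∈q
x∈p─q⇒x∉q (_ ∷ p) (inside ∷ q)  (there x∈) (there x∈q) = x∈p─q⇒x∉q p q x∈ x∈q

x∈p-y⇒x≢y : x ∈ p - y → x ≢ y
x∈p-y⇒x≢y {p = p} {y} x∈ refl = x∈p─q⇒x∉q p ⁅ y ⁆ x∈ (x∈⁅x⁆ y)

∣p∣≡1+∣p-x∣ : x ∈ p → ∣ p ∣ ≡ suc ∣ p - x ∣
∣p∣≡1+∣p-x∣ {p = inside ∷ p}  here      = cong (suc ∘ ∣_∣) (sym (p─⊥≡p p))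
∣p∣≡1+∣p-x∣ {p = inside ∷ p}  (there x∈p) = cong suc (∣p∣≡1+∣p-x∣ x∈p)
∣p∣≡1+∣p-x∣ {p = outside ∷ p} (there x∈p) = ∣p∣≡1+∣p-x∣ x∈p

∪-least : ∀ {r : Subset k} → p ⊆ r → q ⊆ r → p ∪ q ⊆ r
∪-least {p = p} {q} p⊆r q⊆r x∈ with x∈p∪q⁻ p q x∈
... | inj₁ x∈p = p⊆r x∈p
... | inj₂ x∈q = q⊆r x∈q

⁅x⁆⊆p : x ∈ p → ⁅ x ⁆ ⊆ p
⁅x⁆⊆p {x = x} x∈p y∈ = subst (_∈ _) (sym (x∈⁅y⁆⇒x≡y x y∈)) x∈p

p⊂p∪⁅x⁆ : x ∉ p → p ⊂ p ∪ ⁅ x ⁆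
p⊂p∪⁅x⁆ {x = x} x∉p = p⊆p∪q ⁅ x ⁆ , x , x∈p∪q⁺ (inj₂ (x∈⁅x⁆ x)) , x∉p

Empty[p─q]⇒p⊆q : Empty (p ─ q) → p ⊆ q
Empty[p─q]⇒p⊆q {q = q} p─q-empty {x} x∈p =
  decidable-stable (x ∈? q) (λ x∉q → p─q-empty (x , x∈p∧x∉q⇒x∈p─q x∈p x∉q))

∣p∣≡1+∣q∣ : q ⊆ p → x ∈ p ─ q → (∀ {y} → y ∈ p ─ q → y ≡ x) → ∣ p ∣ ≡ suc ∣ q ∣
∣p∣≡1+∣q∣ {q = q} {p = p} {x = x} q⊆p x∈p─q unique = begin
  ∣ p ∣         ≡⟨ ∣p∣≡1+∣p-x∣ (p─q⊆p p q x∈p─q) ⟩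
  suc ∣ p - x ∣ ≡⟨ cong (suc ∘ ∣_∣) (⊆-antisym p-x⊆q q⊆p-x) ⟩
  suc ∣ q ∣     ∎
  where
  open ≡-Reasoning
  p-x⊆q : p - x ⊆ q
  p-x⊆q {y} y∈p-x = decidable-stable (y ∈? q) λ y∉q →
    x∈p-y⇒x≢y y∈p-x (unique (x∈p∧x∉q⇒x∈p─q (p─q⊆p p ⁅ x ⁆ y∈p-x) y∉q))
  q⊆p-x : q ⊆ p - x
  q⊆p-x y∈q = x∈p∧x≢y⇒x∈p-y (q⊆p y∈q) (λ { refl → x∈p─q⇒x∉q p q x∈p─q y∈q })

≟-does⇒≡ : ∀ (x y : Fin k) → does (x ≟ᶠ y) ≡ true → x ≡ y
≟-does⇒≡ x y e with x ≟ᶠ y | e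
... | yes x≡y | _ = x≡y

⊃-wellFounded : WellFounded (_⊃_ {k})
⊃-wellFounded {k} = Subrelation.wellFounded ⊃⇒∸< (On.wellFounded (λ p → k ∸ ∣ p ∣) <-wellFounded)
  where
  ⊃⇒∸< : {p q : Subset k} → p ⊃ q → k ∸ ∣ p ∣ < k ∸ ∣ q ∣
  ⊃⇒∸< {p} q⊂p = ∸-monoʳ-< (p⊂q⇒∣p∣<∣q∣ q⊂p) (∣p∣≤n p)

module _ (G : Graph) where

  private
    variable
      S T M M₁ M₂ : Subset (n G)
      u v w : Fin (n G)

  Adjacent-sym : Adjacent G u v → Adjacent G v u
  Adjacent-sym {u} {v} uv = trans (sym-adj G v u) uv

  Adjacent-irrefl : ¬ Adjacent G v v
  Adjacent-irrefl {v} vv with () ← trans (sym (irrefl G v)) vv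

  adjacent? : ∀ u v → Dec (Adjacent G u v)
  adjacent? u v = Adj G u v ≟ true

  inClosedNbhd? : ∀ S v → Dec (InClosedNbhd G S v)
  inClosedNbhd? S v = (v ∈? S) ⊎-dec any? (λ j → (j ∈? S) ×-dec adjacent? j v)

  InClosedNbhd-mono : S ⊆ T → InClosedNbhd G S v → InClosedNbhd G T v
  InClosedNbhd-mono S⊆T (inj₁ v∈S)             = inj₁ (S⊆T v∈S)
  InClosedNbhd-mono S⊆T (inj₂ (j , j∈S , j~v)) = inj₂ (j , S⊆T j∈S , j~v)

  Dominating : Subset (n G) → Set
  Dominating S = ∀ v → InClosedNbhd G S v

  Independent-⊆ : T ⊆ S → Independent G S → Independent G T
  Independent-⊆ T⊆S indS u v u∈T v∈T = indS u v (T⊆S u∈T) (T⊆S v∈T)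

  Independent-∪⁅⁆ : Independent G S → (∀ s → s ∈ S → ¬ Adjacent G s v) →
                    Independent G (S ∪ ⁅ v ⁆)
  Independent-∪⁅⁆ {S} {v} indS v≁S x y x∈ y∈ with x∈p∪q⁻ S ⁅ v ⁆ x∈ | x∈p∪q⁻ S ⁅ v ⁆ y∈
  ... | inj₁ x∈S | inj₁ y∈S = indS x y x∈S y∈S
  ... | inj₁ x∈S | inj₂ y∈v rewrite x∈⁅y⁆⇒x≡y v y∈v = v≁S x x∈S
  ... | inj₂ x∈v | inj₁ y∈S rewrite x∈⁅y⁆⇒x≡y v x∈v = v≁S y y∈S ∘ Adjacent-sym
  ... | inj₂ x∈v | inj₂ y∈v rewrite x∈⁅y⁆⇒x≡y v x∈v | x∈⁅y⁆⇒x≡y v y∈v = Adjacent-irrefl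

  maximal⇒dominating : MaximalIndependent G M → Dominating M
  maximal⇒dominating {M} (indM , maxM) v with inClosedNbhd? M v
  ... | yes v∈N[M] = v∈N[M]
  ... | no  v∉N[M] = inj₁ (maxM (M ∪ ⁅ v ⁆) ind (λ _ → p⊆p∪q ⁅ v ⁆) v (x∈p∪q⁺ (inj₂ (x∈⁅x⁆ v))))
    where
    ind = Independent-∪⁅⁆ indM (λ s s∈M s~v → v∉N[M] (inj₂ (s , s∈M , s~v)))

  independent∧dominating⇒maximal : Independent G M → Dominating M → MaximalIndependent G M
  independent∧dominating⇒maximal {M} indM domM = indM , grow
    where
    grow : ∀ T → Independent G T → (∀ v → v ∈ M → v ∈ T) → ∀ v → v ∈ T → v ∈ M
    grow T indT M⊆T v v∈T with domM v
    ... | inj₁ v∈M             = v∈M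
    ... | inj₂ (j , j∈M , j~v) = ⊥-elim (indT j v (M⊆T j j∈M) v∈T j~v)

  maximal-⊆⇒≡ : MaximalIndependent G M → Independent G T → M ⊆ T → M ≡ T
  maximal-⊆⇒≡ (_ , maxM) indT M⊆T = ⊆-antisym M⊆T (maxM _ indT (λ _ → M⊆T) _)

  extend-to-maximal : ∀ X → Independent G X → ∃ λ M → MaximalIndependent G M × X ⊆ M
  extend-to-maximal = All.wfRec ⊃-wellFounded _ _ extend
    where
    extend : ∀ X → (∀ {Y} → Y ⊃ X → Independent G Y → ∃ λ M → MaximalIndependent G M × Y ⊆ M) →
             Independent G X → ∃ λ M → MaximalIndependent G M × X ⊆ M
    extend X grow indX with all? (inClosedNbhd? X)
    ... | yes domX = X , independent∧dominating⇒maximal indX domX , id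
    ... | no ¬domX with ¬∀⟶∃¬ _ _ (inClosedNbhd? X) ¬domX
    ...   | v , v∉N[X] with grow (p⊂p∪⁅x⁆ (v∉N[X] ∘ inj₁))
                              (Independent-∪⁅⁆ indX (λ s s∈X s~v → v∉N[X] (inj₂ (s , s∈X , s~v))))
    ...     | M , maxM , X∪v⊆M = M , maxM , X∪v⊆M ∘ p⊆p∪q ⁅ v ⁆

  module _ (no-isolatable : ∀ w → ¬ Isolatable G w) where

    undominated-independent⇒dominating :
      Independent G S →
      (∀ x y → ¬ InClosedNbhd G S x → ¬ InClosedNbhd G S y → ¬ Adjacent G x y) →
      Dominating S
    undominated-independent⇒dominating {S} indS indU v with inClosedNbhd? S v
    ... | yes v∈N[S] = v∈N[S]
    ... | no  v∉N[S] = ⊥-elim (no-isolatable v (J , indJ , v∉N[J] , only-v))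
      where
      undominated? : Decidable (λ x → ¬ InClosedNbhd G S x)
      undominated? x = ¬? (inClosedNbhd? S x)

      U = fromDec undominated?
      J = S ∪ (U - v)

      ∈J⁻ : ∀ {x} → x ∈ J → x ∈ S ⊎ (¬ InClosedNbhd G S x × x ≢ v)
      ∈J⁻ x∈J with x∈p∪q⁻ S (U - v) x∈J
      ... | inj₁ x∈S  = inj₁ x∈S
      ... | inj₂ x∈U-v = inj₂ (∈-fromDec⁻ undominated? (p─q⊆p U ⁅ v ⁆ x∈U-v) , x∈p-y⇒x≢y x∈U-v)

      indJ : Independent G J
      indJ x y x∈J y∈J with ∈J⁻ x∈J | ∈J⁻ y∈J
      ... | inj₁ x∈S         | inj₁ y∈S         = indS x y x∈S y∈S
      ... | inj₁ x∈S         | inj₂ (y∉N[S] , _) = λ x~y → y∉N[S] (inj₂ (x , x∈S , x~y))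
      ... | inj₂ (x∉N[S] , _) | inj₁ y∈S         =
        λ x~y → x∉N[S] (inj₂ (y , y∈S , Adjacent-sym x~y))
      ... | inj₂ (x∉N[S] , _) | inj₂ (y∉N[S] , _) = indU x y x∉N[S] y∉N[S]

      v∉N[J] : ¬ InClosedNbhd G J v
      v∉N[J] (inj₁ v∈J) with ∈J⁻ v∈J
      ... | inj₁ v∈S       = v∉N[S] (inj₁ v∈S)
      ... | inj₂ (_ , v≢v) = v≢v refl
      v∉N[J] (inj₂ (j , j∈J , j~v)) with ∈J⁻ j∈J
      ... | inj₁ j∈S         = v∉N[S] (inj₂ (j , j∈S , j~v))
      ... | inj₂ (j∉N[S] , _) = indU j v j∉N[S] v∉N[S] j~v

      dominated : ∀ {x} → x ≢ v → InClosedNbhd G J x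
      dominated {x} x≢v with inClosedNbhd? S x
      ... | yes x∈N[S] = InClosedNbhd-mono (p⊆p∪q (U - v)) x∈N[S]
      ... | no  x∉N[S] = inj₁ (x∈p∪q⁺ (inj₂ (x∈p∧x≢y⇒x∈p-y (∈-fromDec⁺ undominated? x∉N[S]) x≢v)))

      only-v : ∀ x → ¬ InClosedNbhd G J x → x ≡ v
      only-v x x∉N[J] = decidable-stable (x ≟ᶠ v) (x∉N[J] ∘ dominated)

  TriangleFree : Set
  TriangleFree = ∀ {a b c} → Adjacent G a b → Adjacent G b c → Adjacent G c a → ⊥

  CompletelyJoined : Subset (n G) → Subset (n G) → Set
  CompletelyJoined A B = ∀ {a b} → a ∈ A → b ∈ B → Adjacent G a b

  two-private⇒isolatable :
    TriangleFree → MaximalIndependent G M₁ → MaximalIndependent G M₂ → S ⊆ M₁ →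
    CompletelyJoined (M₁ ─ S) (M₂ ─ S) →
    v ∈ M₁ ─ S → w ∈ M₁ ─ S → w ≢ v → Isolatable G v
  two-private⇒isolatable {M₁} {M₂} {S} {v} {w}
                         triangle-free (ind₁ , max₁) max₂ S⊆M₁ joined v∈ w∈ w≢v =
    M₁ - v , Independent-⊆ (p─q⊆p M₁ ⁅ v ⁆) ind₁ , v∉N[J] , only-v
    where
    J = M₁ - v
    v∈M₁ = p─q⊆p M₁ S v∈

    ∈J : ∀ {x} → x ∈ M₁ → x ≢ v → x ∈ J
    ∈J = x∈p∧x≢y⇒x∈p-y

    v∉N[J] : ¬ InClosedNbhd G J v
    v∉N[J] (inj₁ v∈J)             = x∈p-y⇒x≢y v∈J refl
    v∉N[J] (inj₂ (j , j∈J , j~v)) = ind₁ j v (p─q⊆p M₁ ⁅ v ⁆ j∈J) v∈M₁ j~v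

    -- x is dominated by M₂: by itself (then w is joined to x), by a vertex of S ⊆ M₁, or by a
    -- private vertex of M₂, which is joined to v and would close a triangle v x z.
    neighbour-of-v : ∀ {x} → Adjacent G v x → InClosedNbhd G J x
    neighbour-of-v {x} v~x with maximal⇒dominating max₂ x
    ... | inj₁ x∈M₂ = inj₂ (w , ∈J (p─q⊆p M₁ S w∈) w≢v , joined w∈ (x∈p∧x∉q⇒x∈p─q x∈M₂ x∉S))
      where
      x∉S : x ∉ S
      x∉S x∈S = ind₁ v x v∈M₁ (S⊆M₁ x∈S) v~x
    ... | inj₂ (z , z∈M₂ , z~x) with z ∈? S
    ...   | yes z∈S = inj₂ (z , ∈J (S⊆M₁ z∈S) (λ { refl → x∈p─q⇒x∉q M₁ S v∈ z∈S }) , z~x)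
    ...   | no  z∉S =
      ⊥-elim (triangle-free (joined v∈ (x∈p∧x∉q⇒x∈p─q z∈M₂ z∉S)) z~x (Adjacent-sym v~x))

    dominated : ∀ {x} → x ≢ v → InClosedNbhd G J x
    dominated {x} x≢v with maximal⇒dominating (ind₁ , max₁) x
    ... | inj₁ x∈M₁ = inj₁ (∈J x∈M₁ x≢v)
    ... | inj₂ (z , z∈M₁ , z~x) with z ≟ᶠ v
    ...   | yes refl = neighbour-of-v z~x
    ...   | no  z≢v  = inj₂ (z , ∈J z∈M₁ z≢v , z~x)

    only-v : ∀ x → ¬ InClosedNbhd G J x → x ≡ v
    only-v x x∉N[J] = decidable-stable (x ≟ᶠ v) (x∉N[J] ∘ dominated)

  MaximalSizesAgreeAbove : Subset (n G) → Set
  MaximalSizesAgreeAbove S = ∀ {M₁ M₂} → MaximalIndependent G M₁ → MaximalIndependent G M₂ →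
                             S ⊆ M₁ → S ⊆ M₂ → ∣ M₁ ∣ ≡ ∣ M₂ ∣

  module _ (no-isolatable : ∀ w → ¬ Isolatable G w) (triangle-free : TriangleFree) where

    private-unique : MaximalIndependent G M₁ → MaximalIndependent G M₂ → S ⊆ M₁ →
                     CompletelyJoined (M₁ ─ S) (M₂ ─ S) → v ∈ M₁ ─ S → w ∈ M₁ ─ S → w ≡ v
    private-unique {v = v} {w} max₁ max₂ S⊆M₁ joined v∈ w∈ = decidable-stable (w ≟ᶠ v)
      (no-isolatable v ∘ two-private⇒isolatable triangle-free max₁ max₂ S⊆M₁ joined v∈ w∈)

    sizes-agree-if-joined : MaximalIndependent G M₁ → MaximalIndependent G M₂ → S ⊆ M₁ → S ⊆ M₂ →
                            CompletelyJoined (M₁ ─ S) (M₂ ─ S) → ∣ M₁ ∣ ≡ ∣ M₂ ∣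
    sizes-agree-if-joined {M₁} {M₂} {S} max₁ max₂ S⊆M₁ S⊆M₂ joined
      with nonempty? (M₁ ─ S) | nonempty? (M₂ ─ S)
    ... | no M₁─S-empty | _ =
      cong ∣_∣ (maximal-⊆⇒≡ max₁ (proj₁ max₂) (⊆-trans (Empty[p─q]⇒p⊆q M₁─S-empty) S⊆M₂))
    ... | yes _ | no M₂─S-empty =
      cong ∣_∣ (sym (maximal-⊆⇒≡ max₂ (proj₁ max₁) (⊆-trans (Empty[p─q]⇒p⊆q M₂─S-empty) S⊆M₁)))
    ... | yes (v , v∈) | yes (u , u∈) = begin
      ∣ M₁ ∣    ≡⟨ ∣p∣≡1+∣q∣ S⊆M₁ v∈ (private-unique max₁ max₂ S⊆M₁ joined v∈) ⟩
      suc ∣ S ∣ ≡⟨ ∣p∣≡1+∣q∣ S⊆M₂ u∈ (private-unique max₂ max₁ S⊆M₂ joined′ u∈) ⟨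
      ∣ M₂ ∣    ∎
      where
      open ≡-Reasoning
      joined′ : CompletelyJoined (M₂ ─ S) (M₁ ─ S)
      joined′ a∈ b∈ = Adjacent-sym (joined b∈ a∈)

    sizes-agree-by-exchange :
      (∀ {S′} → S′ ⊃ S → MaximalSizesAgreeAbove S′) →
      MaximalIndependent G M₁ → MaximalIndependent G M₂ → S ⊆ M₁ → S ⊆ M₂ →
      v ∈ M₁ ─ S → u ∈ M₂ ─ S → ¬ Adjacent G v u → ∣ M₁ ∣ ≡ ∣ M₂ ∣
    sizes-agree-by-exchange {S} {M₁} {M₂} {v} {u} above max₁ max₂ S⊆M₁ S⊆M₂ v∈ u∈ v≁u =
      through (extend-to-maximal ((S ∪ ⁅ v ⁆) ∪ ⁅ u ⁆) independent)
      where
      S∪v⊆M₁ : S ∪ ⁅ v ⁆ ⊆ M₁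
      S∪v⊆M₁ = ∪-least S⊆M₁ (⁅x⁆⊆p (p─q⊆p M₁ S v∈))

      S∪u⊆M₂ : S ∪ ⁅ u ⁆ ⊆ M₂
      S∪u⊆M₂ = ∪-least S⊆M₂ (⁅x⁆⊆p (p─q⊆p M₂ S u∈))

      u≁S∪v : ∀ s → s ∈ S ∪ ⁅ v ⁆ → ¬ Adjacent G s u
      u≁S∪v s s∈ with x∈p∪q⁻ S ⁅ v ⁆ s∈
      ... | inj₁ s∈S = proj₁ max₂ s u (S⊆M₂ s∈S) (S∪u⊆M₂ (x∈p∪q⁺ (inj₂ (x∈⁅x⁆ u))))
      ... | inj₂ s∈v rewrite x∈⁅y⁆⇒x≡y v s∈v = v≁u

      independent : Independent G ((S ∪ ⁅ v ⁆) ∪ ⁅ u ⁆)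
      independent = Independent-∪⁅⁆ (Independent-⊆ S∪v⊆M₁ (proj₁ max₁)) u≁S∪v

      S∪u⊆S∪v∪u : S ∪ ⁅ u ⁆ ⊆ (S ∪ ⁅ v ⁆) ∪ ⁅ u ⁆
      S∪u⊆S∪v∪u = ∪-least (p⊆p∪q ⁅ u ⁆ ∘ p⊆p∪q ⁅ v ⁆) (q⊆p∪q (S ∪ ⁅ v ⁆) ⁅ u ⁆)

      through : ∃ (λ M → MaximalIndependent G M × (S ∪ ⁅ v ⁆) ∪ ⁅ u ⁆ ⊆ M) → ∣ M₁ ∣ ≡ ∣ M₂ ∣
      through (M₃ , max₃ , X⊆M₃) = trans
        (above (p⊂p∪⁅x⁆ (x∈p─q⇒x∉q M₁ S v∈)) max₁ max₃ S∪v⊆M₁ (X⊆M₃ ∘ p⊆p∪q ⁅ u ⁆))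
        (above (p⊂p∪⁅x⁆ (x∈p─q⇒x∉q M₂ S u∈)) max₃ max₂ (X⊆M₃ ∘ S∪u⊆S∪v∪u) S∪u⊆M₂)

    maximal-sizes-agree-above : ∀ S → MaximalSizesAgreeAbove S
    maximal-sizes-agree-above = All.wfRec ⊃-wellFounded _ MaximalSizesAgreeAbove step
      where
      step : ∀ S → (∀ {S′} → S′ ⊃ S → MaximalSizesAgreeAbove S′) → MaximalSizesAgreeAbove S
      step S above {M₁} {M₂} max₁ max₂ S⊆M₁ S⊆M₂
        with any? (λ v → any? (λ u → (v ∈? M₁ ─ S) ×-dec (u ∈? M₂ ─ S) ×-dec ¬? (adjacent? v u)))
      ... | yes (v , u , v∈ , u∈ , v≁u) =
        sizes-agree-by-exchange above max₁ max₂ S⊆M₁ S⊆M₂ v∈ u∈ v≁u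
      ... | no ¬nonadjacent-pair = sizes-agree-if-joined max₁ max₂ S⊆M₁ S⊆M₂ λ {a} {b} a∈ b∈ →
        decidable-stable (adjacent? a b) λ a≁b → ¬nonadjacent-pair (a , b , a∈ , b∈ , a≁b)

    wellCovered : WellCovered G
    wellCovered _ _ max₁ max₂ = maximal-sizes-agree-above ∅ max₁ max₂ ⊥⊆ ⊥⊆

Independent-preimage : ∀ (G H : Graph) (f : Fin (n G) → Fin (n H)) →
  (∀ {a b} → Adjacent G a b → Adjacent H (f a) (f b)) →
  ∀ {I} → Independent H I → Independent G (preimage f I)
Independent-preimage G H f hom indI a b a∈ b∈ =
  indI (f a) (f b) (∈-preimage⁻ a∈) (∈-preimage⁻ b∈) ∘ hom

module _ (G : Graph) where

  private
    m = n G
    P = prism G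

  vertex : Fin m ⊎ Fin m → Fin (n P)
  vertex = join m m

  Adj-vertex : ∀ x y → Adj P (vertex x) (vertex y) ≡ prismAdj⊎ (Adj G) x y
  Adj-vertex x y rewrite splitAt-join m m x | splitAt-join m m y = refl

  -- top/bottom name the two sides of the prism, so that one proof serves both layers.
  module Layer
    (top bottom : Fin m → Fin m ⊎ Fin m)
    (top-adj    : ∀ a b → prismAdj⊎ (Adj G) (top a) (top b) ≡ Adj G a b)
    (bottom-adj : ∀ a b → prismAdj⊎ (Adj G) (bottom a) (bottom b) ≡ Adj G a b)
    (rung       : ∀ a b → prismAdj⊎ (Adj G) (bottom a) (top b) ≡ does (a ≟ᶠ b))
    (cover      : ∀ x → (∃ λ g → x ≡ top g) ⊎ (∃ λ g → x ≡ bottom g))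
    where

    adj-top : ∀ a b → Adj P (vertex (top a)) (vertex (top b)) ≡ Adj G a b
    adj-top a b = trans (Adj-vertex (top a) (top b)) (top-adj a b)

    adj-bottom : ∀ a b → Adj P (vertex (bottom a)) (vertex (bottom b)) ≡ Adj G a b
    adj-bottom a b = trans (Adj-vertex (bottom a) (bottom b)) (bottom-adj a b)

    adj-rung : ∀ a b → Adj P (vertex (bottom a)) (vertex (top b)) ≡ does (a ≟ᶠ b)
    adj-rung a b = trans (Adj-vertex (bottom a) (top b)) (rung a b)

    vertex-cases : ∀ q → (∃ λ g → q ≡ vertex (top g)) ⊎ (∃ λ g → q ≡ vertex (bottom g))
    vertex-cases q with cover (splitAt m q)
    ... | inj₁ (g , e) = inj₁ (g , trans (sym (join-splitAt m m q)) (cong vertex e))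
    ... | inj₂ (g , e) = inj₂ (g , trans (sym (join-splitAt m m q)) (cong vertex e))

    layer-maximal : (∀ w → ¬ Isolatable G w) →
      ∀ {I} → MaximalIndependent P I → MaximalIndependent G (preimage (vertex ∘ top) I)
    layer-maximal no-isolatable {I} (indI , maxI) =
      independent∧dominating⇒maximal G indA
        (undominated-independent⇒dominating G no-isolatable indA undominated-nonadjacent)
      where
      A = preimage (vertex ∘ top) I
      B = preimage (vertex ∘ bottom) I

      indA : Independent G A
      indA = Independent-preimage G P (vertex ∘ top) (λ {a} {b} → trans (adj-top a b)) indI

      indB : Independent G B
      indB = Independent-preimage G P (vertex ∘ bottom) (λ {a} {b} → trans (adj-bottom a b)) indI

      undominated⇒∈B : ∀ {x} → ¬ InClosedNbhd G A x → x ∈ B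
      undominated⇒∈B {x} x∉N[A] with maximal⇒dominating P (indI , maxI) (vertex (top x))
      ... | inj₁ top-x∈I = ⊥-elim (x∉N[A] (inj₁ (∈-preimage⁺ top-x∈I)))
      ... | inj₂ (q , q∈I , q~top-x) with vertex-cases q
      ...   | inj₁ (g , refl) =
        ⊥-elim (x∉N[A] (inj₂ (g , ∈-preimage⁺ q∈I , trans (sym (adj-top g x)) q~top-x)))
      ...   | inj₂ (g , refl) with ≟-does⇒≡ g x (trans (sym (adj-rung g x)) q~top-x)
      ...     | refl = ∈-preimage⁺ q∈I

      undominated-nonadjacent :
        ∀ x y → ¬ InClosedNbhd G A x → ¬ InClosedNbhd G A y → ¬ Adjacent G x y
      undominated-nonadjacent x y x∉N[A] y∉N[A] =
        indB x y (undominated⇒∈B x∉N[A]) (undominated⇒∈B y∉N[A])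

  private
    cover-id : ∀ (x : Fin m ⊎ Fin m) → (∃ λ g → x ≡ inj₁ g) ⊎ (∃ λ g → x ≡ inj₂ g)
    cover-id (inj₁ g) = inj₁ (g , refl)
    cover-id (inj₂ g) = inj₂ (g , refl)

    cover-swap : ∀ (x : Fin m ⊎ Fin m) → (∃ λ g → x ≡ inj₂ g) ⊎ (∃ λ g → x ≡ inj₁ g)
    cover-swap (inj₁ g) = inj₂ (g , refl)
    cover-swap (inj₂ g) = inj₁ (g , refl)

  module Upper = Layer inj₁ inj₂ (λ _ _ → refl) (λ _ _ → refl) (λ _ _ → refl) cover-id
  module Lower = Layer inj₂ inj₁ (λ _ _ → refl) (λ _ _ → refl) (λ _ _ → refl) cover-swap

  prism-wellCovered : (∀ w → ¬ Isolatable G w) → WellCovered G → WellCovered P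
  prism-wellCovered no-isolatable wc I₁ I₂ max₁ max₂ = begin
    ∣ I₁ ∣                      ≡⟨ ∣p∣≡∣preimage↑ˡ∣+∣preimage↑ʳ∣ m I₁ ⟩
    ∣ upper I₁ ∣ + ∣ lower I₁ ∣ ≡⟨ cong₂ _+_ (wc _ _ (upper-max max₁) (upper-max max₂))
                                            (wc _ _ (lower-max max₁) (lower-max max₂)) ⟩
    ∣ upper I₂ ∣ + ∣ lower I₂ ∣ ≡⟨ ∣p∣≡∣preimage↑ˡ∣+∣preimage↑ʳ∣ m I₂ ⟨
    ∣ I₂ ∣                      ∎
    where
    open ≡-Reasoning
    upper lower : Subset (n P) → Subset m
    upper = preimage (_↑ˡ m)
    lower = preimage (m ↑ʳ_)
    upper-max = Upper.layer-maximal no-isolatable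
    lower-max = Lower.layer-maximal no-isolatable

triangle⇒3-cycle : ∀ (G : Graph) {a b c} →
  Adjacent G a b → Adjacent G b c → Adjacent G c a → HasCycle G 3
triangle⇒3-cycle G {a} {b} {c} ab bc ca = ≤-refl , f , injective , consecutive
  where
  f : Fin 3 → Fin (n G)
  f zero             = a
  f (suc zero)       = b
  f (suc (suc zero)) = c

  ≢-of-adjacent : ∀ {x y} → Adjacent G x y → x ≢ y
  ≢-of-adjacent x~y refl = Adjacent-irrefl G x~y

  injective : ∀ {i j} → f i ≡ f j → i ≡ j
  injective {zero}             {zero}             _ = refl
  injective {suc zero}         {suc zero}         _ = refl
  injective {suc (suc zero)}   {suc (suc zero)}   _ = refl
  injective {zero}             {suc zero}         e = ⊥-elim (≢-of-adjacent ab e)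
  injective {suc zero}         {zero}             e = ⊥-elim (≢-of-adjacent ab (sym e))
  injective {suc zero}         {suc (suc zero)}   e = ⊥-elim (≢-of-adjacent bc e)
  injective {suc (suc zero)}   {suc zero}         e = ⊥-elim (≢-of-adjacent bc (sym e))
  injective {suc (suc zero)}   {zero}             e = ⊥-elim (≢-of-adjacent ca e)
  injective {zero}             {suc (suc zero)}   e = ⊥-elim (≢-of-adjacent ca (sym e))

  consecutive : ∀ i j → (suc (toℕ i) ≡ toℕ j ⊎ (suc (toℕ i) ≡ 3 × toℕ j ≡ 0)) →
                Adjacent G (f i) (f j)
  consecutive zero             (suc zero)       _ = ab
  consecutive (suc zero)       (suc (suc zero)) _ = bc
  consecutive (suc (suc zero)) zero             _ = ca
  consecutive zero             zero             (inj₁ ())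
  consecutive zero             zero             (inj₂ (() , _))
  consecutive zero             (suc (suc zero)) (inj₁ ())
  consecutive zero             (suc (suc zero)) (inj₂ (() , _))
  consecutive (suc zero)       zero             (inj₁ ())
  consecutive (suc zero)       zero             (inj₂ (() , _))
  consecutive (suc zero)       (suc zero)       (inj₁ ())
  consecutive (suc zero)       (suc zero)       (inj₂ (() , _))
  consecutive (suc (suc zero)) (suc zero)       (inj₁ ())
  consecutive (suc (suc zero)) (suc zero)       (inj₂ (_ , ()))
  consecutive (suc (suc zero)) (suc (suc zero)) (inj₁ ())
  consecutive (suc (suc zero)) (suc (suc zero)) (inj₂ (_ , ()))

girth4⇒triangleFree : ∀ (G : Graph) → HasGirth G 4 → TriangleFree G
girth4⇒triangleFree G (_ , no-shorter-cycle) ab bc ca =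
  no-shorter-cycle 3 ≤-refl (triangle⇒3-cycle G ab bc ca)

corollary3p10 : (G : Graph) → HasGirth G 4 → (∀ (w : Fin (n G)) → ¬ Isolatable G w) →
    WellCovered (prism G)
corollary3p10 G girth4 no-isolatable =
  prism-wellCovered G no-isolatable (wellCovered G no-isolatable (girth4⇒triangleFree G girth4))
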